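{- Let $A$ be a set of positive integers with $1\notin A$ and asymptotic density $\mathbf{d}A=1$. Assume $A$ contains an infinite set of pairwise coprime integers $a_1<a_2<\cdots$ with $\sum_{i\ge1}1/a_i=\infty$. Then $A^2=\{ab:a,b\in A\}$ has asymptotic density $1$.
   Context: The asymptotic density of $S\subseteq\mathbb{N}$ is $\lim_{n\to\infty}|S\cap[1,n]|/n$ when the limit exists. -}

module Defs where

open import Data.Nat using (ℕ; zero; suc; _*_)
open import Data.Nat.Coprimality using (Coprime)
open import Data.Bool using (Bool; true; false; if_then_else_; _∧_)
open import Data.List using (upTo)
open import Data.Bool.ListAction using (any)
open import Data.Integer using (+_)
open import Data.Rational using (ℚ; _/_; _-_; ∣_∣; _≤_; _<_; _+_; 0ℚ)
open import Relation.Nullary.Decidable using (⌊_⌋)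
open import Relation.Binary.PropositionalEquality using (_≡_; _≢_)
open import Data.Product using (Σ; ∃; _×_)
import Data.Nat as ℕ

Subset : Set
Subset = ℕ → Bool

count : Subset → ℕ → ℕ
count S zero    = 0
count S (suc n) = (if S (suc n) then 1 else 0) ℕ.+ count S n

-- S has asymptotic density d: |S ∩ [1,n]| / n → d as n → ∞
-- (written with n = suc m to avoid division by zero).
HasDensity : Subset → ℚ → Set
HasDensity S d =
  ∀ (ε : ℚ) → 0ℚ < ε →
    ∃ λ N → ∀ m → N ℕ.≤ m →
      ∣ ((+ count S (suc m)) / suc m) - d ∣ ≤ ε

-- Product set S² = { a * b : a ∈ S, b ∈ S }, membership by bounded search
-- (a, b ≤ m suffices whenever m ≥ 1 and a*b = m).
ProdSet : Subset → Subset
ProdSet S m =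
  any (λ a → any (λ b → S a ∧ (S b ∧ ⌊ a * b ℕ.≟ m ⌋)) (upTo (suc m))) (upTo (suc m))

-- reciprocal of a natural number (1/0 := 0; only used on nonzero arguments)
recip : ℕ → ℚ
recip zero    = 0ℚ
recip (suc n) = (+ 1) / suc n

recipSum : (ℕ → ℕ) → ℕ → ℚ
recipSum a zero    = 0ℚ
recipSum a (suc k) = recipSum a k + recip (a k)

-- If n ∉ A² and aᵢ ∣ n, then n / aᵢ ∉ A,
-- so for every k the complement of A² is covered by the integers divisible by none of
-- a₀, …, a_{k-1} together with the sets aᵢ · (ℕ ∖ A), i < k. The latter have density zero
-- because ℕ ∖ A has. By coprimality the former has n · ∏_{i<k} (1 - 1/aᵢ) elements up to n, with
-- an error bounded independently of n, and ∏_{i<k} (1 - 1/aᵢ) · (1 + ∑_{i<k} 1/aᵢ) ≤ 1, so this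
-- density tends to 0 as k grows because the reciprocal sum diverges.
module Submission where

open import Data.Bool using (true; false; not; _∧_; _∨_; if_then_else_; T)
open import Data.Bool.ListAction using (any)
open import Data.Bool.Properties using (∧-zeroʳ; ∧-identityʳ; ∨-zeroʳ; ∨-identityʳ; T-≡)
open import Data.Integer as ℤ using (ℤ; +_; -[1+_]; +[1+_])
import Data.Integer.Properties as ℤ
import Data.Integer.Tactic.RingSolver as ℤ-Solver
open import Data.List using ([]; _∷_; upTo)
open import Data.List.Membership.Propositional.Properties using (∈-upTo⁺)
import Data.List.Relation.Unary.Any as Any
open import Data.List.Relation.Unary.Any.Properties using (any⁺)
open import Data.Nat using (ℕ; zero; suc; _+_; _*_; _∸_; _≤_; _<_; _⊔_; z≤n; s≤s; NonZero; ≢-nonZero)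
open import Data.Nat.Coprimality using (Coprime; coprime-divisor)
open import Data.Nat.DivMod using (_/_; _%_; m≡m%n+[m/n]*n; m%n<n; m*n/n≡m; m/n*n≡m; m*[n/m]≡n; m/n≤m)
open import Data.Nat.Divisibility using (_∣_; _∣?_; ∣m+n∣m⇒∣n; n∣m*n; m∣m*n; ∣-trans; ∣⇒≤)
open import Data.Nat.Properties
open import Data.Nat.Tactic.RingSolver using (solve; solve-∀)
open import Data.Product using (∃; _,_)
open import Data.Rational as ℚ using (mkℚ; 1ℚ; toℚᵘ)
import Data.Rational.Properties as ℚ
open import Data.Rational.Unnormalised as ℚᵘ using (mkℚᵘ; *≡*; *≤*)
import Data.Rational.Unnormalised.Properties as ℚᵘ
open import Data.Sum using (inj₁; inj₂)
open import Function.Bundles using (mk⇔; Equivalence)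
open import Relation.Binary.PropositionalEquality
open import Relation.Nullary using (¬_; does; contradiction)
open import Relation.Nullary.Decidable using (⌊_⌋; yes; no; does-⇔; fromWitness)

open import Defs

∅ : Subset
∅ _ = false

∁ : Subset → Subset
∁ S n = not (S n)

_∪_ _∩_ : Subset → Subset → Subset
(S ∪ T) n = S n ∨ T n
(S ∩ T) n = S n ∧ T n

_⊆_ : Subset → Subset → Set
S ⊆ T = ∀ n → S n ≡ true → T n ≡ true

divisibleBy : ℕ → Subset
divisibleBy d n = does (d ∣? n)

multiples : (d : ℕ) .{{_ : NonZero d}} → Subset → Subset
multiples d S n = divisibleBy d n ∧ S (n / d)

count-cong : ∀ {S T} → (∀ n → S n ≡ T n) → ∀ N → count S N ≡ count T N
count-cong S≗T zero    = refl
count-cong S≗T (suc N) = cong₂ (λ b c → (if b then 1 else 0) + c) (S≗T (suc N)) (count-cong S≗T N)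

count-mono-⊆ : ∀ {S T} → S ⊆ T → ∀ N → count S N ≤ count T N
count-mono-⊆ S⊆T zero = z≤n
count-mono-⊆ {S} {T} S⊆T (suc N) with S (suc N) in Sn | T (suc N) in Tn
... | true  | true  = s≤s (count-mono-⊆ S⊆T N)
... | true  | false with () ← trans (sym (S⊆T (suc N) Sn)) Tn
... | false | true  = m≤n⇒m≤1+n (count-mono-⊆ S⊆T N)
... | false | false = count-mono-⊆ S⊆T N

count-≤ : ∀ S N → count S N ≤ N
count-≤ S zero = z≤n
count-≤ S (suc N) with S (suc N)
... | true  = s≤s (count-≤ S N)
... | false = m≤n⇒m≤1+n (count-≤ S N)

count-monoʳ-≤ : ∀ S {M N} → M ≤ N → count S M ≤ count S N
count-monoʳ-≤ S {N = zero}  z≤n = z≤n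
count-monoʳ-≤ S {M} {suc N} M≤1+N with m≤n⇒m<n∨m≡n M≤1+N
... | inj₂ refl      = ≤-refl
... | inj₁ (s≤s M≤N) with S (suc N)
...   | true  = m≤n⇒m≤1+n (count-monoʳ-≤ S M≤N)
...   | false = count-monoʳ-≤ S M≤N

count-∪ : ∀ S T N → count (S ∪ T) N ≤ count S N + count T N
count-∪ S T zero = z≤n
count-∪ S T (suc N) with S (suc N) | T (suc N)
... | true  | true  = s≤s (≤-trans (count-∪ S T N) (+-monoʳ-≤ (count S N) (n≤1+n _)))
... | true  | false = s≤s (count-∪ S T N)
... | false | true  = ≤-trans (s≤s (count-∪ S T N)) (≤-reflexive (sym (+-suc _ _)))
... | false | false = count-∪ S T N

count-∁ : ∀ S N → count (∁ S) N ≡ N ∸ count S N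
count-∁ S zero = refl
count-∁ S (suc N) with S (suc N) | count-∁ S N | count-≤ S N
... | true  | eq | _  = eq
... | false | eq | le = trans (cong suc eq) (sym (+-∸-assoc 1 le))

count-∩-∁ : ∀ S T N → count S N ≡ count (S ∩ T) N + count (S ∩ ∁ T) N
count-∩-∁ S T zero = refl
count-∩-∁ S T (suc N) with S (suc N) | T (suc N)
... | true  | true  = cong suc (count-∩-∁ S T N)
... | true  | false = trans (cong suc (count-∩-∁ S T N)) (sym (+-suc _ _))
... | false | _     = count-∩-∁ S T N

multiples-∣ : ∀ d .{{_ : NonZero d}} S m → multiples d S (m * d) ≡ S m
multiples-∣ d S m with d ∣? m * d
... | yes _   = cong S (m*n/n≡m m d)
... | no d∤md = contradiction (n∣m*n m) d∤md

multiples-∤ : ∀ d .{{_ : NonZero d}} S {n} → ¬ d ∣ n → multiples d S n ≡ false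
multiples-∤ d S {n} d∤n with d ∣? n
... | yes d∣n = contradiction d∣n d∤n
... | no _    = refl

count-multiples-gap : ∀ d .{{_ : NonZero d}} S m {j} → j < d →
  count (multiples d S) (j + m * d) ≡ count (multiples d S) (m * d)
count-multiples-gap d S m {zero}  _     = refl
count-multiples-gap d S m {suc j} 1+j<d =
  trans (cong (λ b → (if b then 1 else 0) + count (multiples d S) (j + m * d)) (multiples-∤ d S d∤))
        (count-multiples-gap d S m (<-trans (n<1+n j) 1+j<d))
  where
  d∤ : ¬ d ∣ suc j + m * d
  d∤ d∣ = <⇒≱ 1+j<d (∣⇒≤ (∣m+n∣m⇒∣n (subst (d ∣_) (+-comm (suc j) (m * d)) d∣) (n∣m*n m)))

count-multiples-block : ∀ d .{{_ : NonZero d}} S m → count (multiples d S) (m * d) ≡ count S m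
count-multiples-block d       S zero    = refl
count-multiples-block d@(suc b) S (suc m) =
  cong₂ (λ b c → (if b then 1 else 0) + c) (multiples-∣ d S (suc m))
        (trans (count-multiples-gap d S m ≤-refl) (count-multiples-block d S m))

count-multiples : ∀ d .{{_ : NonZero d}} S N → count (multiples d S) N ≡ count S (N / d)
count-multiples d S N = begin
  count (multiples d S) N                       ≡⟨ cong (count (multiples d S)) (m≡m%n+[m/n]*n N d) ⟩
  count (multiples d S) (N % d + N / d * d)     ≡⟨ count-multiples-gap d S (N / d) (m%n<n N d) ⟩
  count (multiples d S) (N / d * d)             ≡⟨ count-multiples-block d S (N / d) ⟩
  count S (N / d)                               ∎
  where open ≡-Reasoning

count-multiples-≤ : ∀ d .{{_ : NonZero d}} S N → count (multiples d S) N ≤ count S N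
count-multiples-≤ d S N = ≤-trans (≤-reflexive (count-multiples d S N)) (count-monoʳ-≤ S (m/n≤m N d))

Sparse : ℕ → Subset → Set
Sparse r S = ∃ λ N₀ → ∀ n → N₀ ≤ n → r * count S n ≤ n

DensityZero : Subset → Set
DensityZero S = ∀ r → Sparse r S

sparse-≤ : ∀ {r S T} → (∀ n → count S n ≤ count T n) → Sparse r T → Sparse r S
sparse-≤ {r} S≤T (N₀ , sparse) = N₀ , λ n N₀≤n → ≤-trans (*-monoʳ-≤ r (S≤T n)) (sparse n N₀≤n)

sparse-∪ : ∀ {r S T} → Sparse (2 * r) S → Sparse (2 * r) T → Sparse r (S ∪ T)
sparse-∪ {r} {S} {T} (N₁ , sparseS) (N₂ , sparseT) = N₁ ⊔ N₂ , λ n N≤n →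
  *-cancelˡ-≤ 2 (begin
    2 * (r * count (S ∪ T) n)              ≡⟨ *-assoc 2 r _ ⟨
    2 * r * count (S ∪ T) n                ≤⟨ *-monoʳ-≤ (2 * r) (count-∪ S T n) ⟩
    2 * r * (count S n + count T n)        ≡⟨ *-distribˡ-+ (2 * r) (count S n) _ ⟩
    2 * r * count S n + 2 * r * count T n
      ≤⟨ +-mono-≤ (sparseS n (≤-trans (m≤m⊔n N₁ N₂) N≤n)) (sparseT n (≤-trans (m≤n⊔m N₁ N₂) N≤n)) ⟩
    n + n                                  ≡⟨ solve (n ∷ []) ⟩
    2 * n                                  ∎)
  where open ≤-Reasoning

densityZero-∅ : DensityZero ∅
densityZero-∅ r = 0 , λ n _ → ≤-trans (≤-reflexive (trans (cong (r *_) (count-∅ n)) (*-zeroʳ r))) z≤n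
  where
  count-∅ : ∀ n → count ∅ n ≡ 0
  count-∅ zero    = refl
  count-∅ (suc n) = count-∅ n

densityZero-∪ : ∀ {S T} → DensityZero S → DensityZero T → DensityZero (S ∪ T)
densityZero-∪ {S} {T} dzS dzT r = sparse-∪ {r} {S} {T} (dzS (2 * r)) (dzT (2 * r))

densityZero-multiples : ∀ d .{{_ : NonZero d}} {S} → DensityZero S → DensityZero (multiples d S)
densityZero-multiples d {S} dzS r = sparse-≤ {r} (count-multiples-≤ d S) (dzS r)

count-bound⇒sparse : ∀ {S} P Q E r .{{_ : NonZero P}} →
  (∀ n → P * count S n ≤ Q * n + E) → 2 * r * Q ≤ P → Sparse r S
count-bound⇒sparse {S} P Q E r bound 2rQ≤P = 2 * r * E , λ n 2rE≤n →
  *-cancelˡ-≤ 2 (*-cancelˡ-≤ P (doubled n (count S n) (bound n) 2rE≤n))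
  where
  open ≤-Reasoning
  doubled : ∀ n c → P * c ≤ Q * n + E → 2 * r * E ≤ n → P * (2 * (r * c)) ≤ P * (2 * n)
  doubled n c Pc≤Qn+E 2rE≤n = begin
    P * (2 * (r * c))               ≡⟨ solve (P ∷ r ∷ c ∷ []) ⟩
    2 * r * (P * c)                 ≤⟨ *-monoʳ-≤ (2 * r) Pc≤Qn+E ⟩
    2 * r * (Q * n + E)             ≡⟨ solve (r ∷ Q ∷ n ∷ E ∷ []) ⟩
    2 * r * Q * n + 2 * r * E       ≤⟨ +-mono-≤ (*-monoˡ-≤ n 2rQ≤P) (≤-trans 2rE≤n (m≤n*m n P)) ⟩
    P * n + P * n                   ≡⟨ solve (P ∷ n ∷ []) ⟩
    P * (2 * n)                     ∎

mkℚᵘ-≤⇒ : ∀ {k m p d} → mkℚᵘ (+ k) m ℚᵘ.≤ mkℚᵘ (+ p) d → k * suc d ≤ p * suc m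
mkℚᵘ-≤⇒ {k} {m} {p} {d} (*≤* le) = ℤ.drop‿+≤+ (subst₂ ℤ._≤_ (sym (ℤ.pos-* k (suc d))) (sym (ℤ.pos-* p (suc m))) le)

≤⇒mkℚᵘ-≤ : ∀ {k m p d} → k * suc d ≤ p * suc m → mkℚᵘ (+ k) m ℚᵘ.≤ mkℚᵘ (+ p) d
≤⇒mkℚᵘ-≤ {k} {m} {p} {d} le = *≤* (subst₂ ℤ._≤_ (ℤ.pos-* k (suc d)) (ℤ.pos-* p (suc m)) (ℤ.+≤+ le))

∣c/n-1∣≃ : ∀ c m → c ≤ suc m → toℚᵘ ℚ.∣ (+ c) ℚ./ suc m ℚ.- 1ℚ ∣ ℚᵘ.≃ mkℚᵘ (+ (suc m ∸ c)) m
∣c/n-1∣≃ c m c≤n = begin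
  toℚᵘ ℚ.∣ (+ c) ℚ./ suc m ℚ.- 1ℚ ∣             ≈⟨ ℚ.toℚᵘ-homo-∣-∣ ((+ c) ℚ./ suc m ℚ.- 1ℚ) ⟩
  ℚᵘ.∣ toℚᵘ ((+ c) ℚ./ suc m ℚ.- 1ℚ) ∣           ≈⟨ ℚᵘ.∣-∣-cong (ℚ.toℚᵘ-homo-+ ((+ c) ℚ./ suc m) (ℚ.- 1ℚ)) ⟩
  ℚᵘ.∣ toℚᵘ ((+ c) ℚ./ suc m) ℚᵘ.+ toℚᵘ (ℚ.- 1ℚ) ∣
    ≈⟨ ℚᵘ.∣-∣-cong (ℚᵘ.+-congˡ (toℚᵘ (ℚ.- 1ℚ)) (ℚ.toℚᵘ-fromℚᵘ (mkℚᵘ (+ c) m))) ⟩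
  ℚᵘ.∣ mkℚᵘ (+ c) m ℚᵘ.+ mkℚᵘ -[1+ 0 ] 0 ∣        ≈⟨ *≡* cross ⟩
  mkℚᵘ (+ (suc m ∸ c)) m                          ∎
  where
  open ℚᵘ.≃-Reasoning
  k = suc m ∸ c
  x-[x+y]≡-y : ∀ x y → x ℤ.* + 1 ℤ.+ ℤ.- + 1 ℤ.* (x ℤ.+ y) ≡ ℤ.- y
  x-[x+y]≡-y = ℤ-Solver.solve-∀
  c-n≡-k : + c ℤ.* + 1 ℤ.+ -[1+ 0 ] ℤ.* + suc m ≡ ℤ.- (+ k)
  c-n≡-k = trans (cong (λ n → + c ℤ.* + 1 ℤ.+ -[1+ 0 ] ℤ.* n) (trans (cong +_ (sym (m+[n∸m]≡n c≤n))) (ℤ.pos-+ c k)))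
                 (x-[x+y]≡-y (+ c) (+ k))
  cross : + ℤ.∣ + c ℤ.* + 1 ℤ.+ -[1+ 0 ] ℤ.* + suc m ∣ ℤ.* + suc m ≡ + k ℤ.* + (suc m * 1)
  cross = cong₂ (λ i n → + i ℤ.* + n) (trans (cong ℤ.∣_∣ c-n≡-k) (ℤ.∣-i∣≡∣i∣ (+ k))) (sym (*-identityʳ (suc m)))

density-1⇒∁-densityZero : ∀ S → HasDensity S 1ℚ → DensityZero (∁ S)
density-1⇒∁-densityZero S dens zero    = 0 , λ n _ → z≤n
density-1⇒∁-densityZero S dens (suc r) with dens (+ 1 ℚ./ suc r) (ℚ.positive⁻¹ _ {{ℚ.normalize-pos 1 (suc r)}})
... | N , close = suc N , sparse
  where
  sparse : ∀ n → suc N ≤ n → suc r * count (∁ S) n ≤ n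
  sparse (suc m) (s≤s N≤m) = begin
    suc r * count (∁ S) (suc m)   ≡⟨ cong (suc r *_) (count-∁ S (suc m)) ⟩
    suc r * (suc m ∸ c)           ≡⟨ *-comm (suc r) (suc m ∸ c) ⟩
    (suc m ∸ c) * suc r           ≤⟨ mkℚᵘ-≤⇒ close′ ⟩
    1 * suc m                     ≡⟨ *-identityˡ (suc m) ⟩
    suc m                         ∎
    where
    open ≤-Reasoning
    c = count S (suc m)
    close′ : mkℚᵘ (+ (suc m ∸ c)) m ℚᵘ.≤ mkℚᵘ (+ 1) r
    close′ = ℚᵘ.≤-respˡ-≃ (∣c/n-1∣≃ c m (count-≤ S (suc m)))
               (ℚᵘ.≤-respʳ-≃ (ℚ.toℚᵘ-fromℚᵘ (mkℚᵘ (+ 1) r)) (ℚ.toℚᵘ-mono-≤ (close m N≤m)))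

∁-densityZero⇒density-1 : ∀ S → DensityZero (∁ S) → HasDensity S 1ℚ
∁-densityZero⇒density-1 S dz ε ε>0 = close ε {{ℚ.positive ε>0}}
  where
  close : ∀ ε .{{_ : ℚ.Positive ε}} → ∃ λ N → ∀ m → N ≤ m → ℚ.∣ (+ count S (suc m)) ℚ./ suc m ℚ.- 1ℚ ∣ ℚ.≤ ε
  close (mkℚ +[1+ p ] d _) with dz (suc d)
  ... | N₀ , sparse = N₀ , λ m N₀≤m →
    ℚ.toℚᵘ-cancel-≤ (ℚᵘ.≤-respˡ-≃ (ℚᵘ.≃-sym (∣c/n-1∣≃ _ m (count-≤ S (suc m))))
      (≤⇒mkℚᵘ-≤ (begin
        (suc m ∸ count S (suc m)) * suc d   ≡⟨ *-comm _ (suc d) ⟩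
        suc d * (suc m ∸ count S (suc m))   ≡⟨ cong (suc d *_) (count-∁ S (suc m)) ⟨
        suc d * count (∁ S) (suc m)         ≤⟨ sparse (suc m) (m≤n⇒m≤1+n N₀≤m) ⟩
        suc m                               ≤⟨ m≤n*m (suc m) (suc p) ⟩
        suc p * suc m                       ∎)))
    where open ≤-Reasoning

m≤n+∣[+m]-[+n]∣ : ∀ m n → m ≤ n + ℤ.∣ + m ℤ.- + n ∣
m≤n+∣[+m]-[+n]∣ m n with ≤-total m n
... | inj₁ m≤n = ≤-trans m≤n (m≤m+n n _)
... | inj₂ n≤m = ≤-reflexive (sym (begin
  n + ℤ.∣ + m ℤ.- + n ∣    ≡⟨ cong (λ i → n + ℤ.∣ i ∣) (trans (ℤ.[+m]-[+n]≡m⊖n m n) (ℤ.⊖-≥ n≤m)) ⟩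
  n + (m ∸ n)              ≡⟨ m+[n∸m]≡n n≤m ⟩
  m                        ∎))
  where open ≡-Reasoning

∣ai-aj+k∣≤ : ∀ a i j k → ℤ.∣ + a ℤ.* i ℤ.- + a ℤ.* j ℤ.+ + k ∣ ≤ a * ℤ.∣ i ∣ + a * ℤ.∣ j ∣ + k
∣ai-aj+k∣≤ a i j k = begin
  ℤ.∣ + a ℤ.* i ℤ.- + a ℤ.* j ℤ.+ + k ∣              ≤⟨ ℤ.∣i+j∣≤∣i∣+∣j∣ (+ a ℤ.* i ℤ.- + a ℤ.* j) (+ k) ⟩
  ℤ.∣ + a ℤ.* i ℤ.- + a ℤ.* j ∣ + k                  ≤⟨ +-monoˡ-≤ k (ℤ.∣i-j∣≤∣i∣+∣j∣ (+ a ℤ.* i) (+ a ℤ.* j)) ⟩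
  ℤ.∣ + a ℤ.* i ∣ + ℤ.∣ + a ℤ.* j ∣ + k              ≡⟨ cong₂ (λ u v → u + v + k) (ℤ.abs-* (+ a) i) (ℤ.abs-* (+ a) j) ⟩
  a * ℤ.∣ i ∣ + a * ℤ.∣ j ∣ + k                      ∎
  where open ≤-Reasoning

-- Sieving [1, N] by a removes the multiples of a, which correspond to the survivors up to N / a.
-- So if x + y and y are the counts before sieving up to N and N / a, and x the count after, the
-- new error term is a combination of the two old ones plus Q · (N % a).
sieve-error-step : ∀ a .{{_ : NonZero a}} P Q x y N →
  + (a * P * x) ℤ.- + ((a ∸ 1) * Q * N) ≡
  + a ℤ.* (+ (P * (x + y)) ℤ.- + (Q * N)) ℤ.- + a ℤ.* (+ (P * y) ℤ.- + (Q * (N / a))) ℤ.+ + (Q * (N % a))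
sieve-error-step a@(suc b) P Q x y N = begin
  + (a * P * x) ℤ.- + (b * Q * N)
    ≡⟨ cong₂ ℤ._-_ (trans (ℤ.pos-* (a * P) x) (cong (ℤ._* + x) (ℤ.pos-* a P)))
                   (trans (ℤ.pos-* (b * Q) N) (cong₂ ℤ._*_ (ℤ.pos-* b Q) +N)) ⟩
  + a ℤ.* + P ℤ.* + x ℤ.- + b ℤ.* + Q ℤ.* (+ j ℤ.+ + m ℤ.* + a)
    ≡⟨ identity (+ b) (+ P) (+ Q) (+ x) (+ y) (+ m) (+ j) ⟩
  + a ℤ.* (+ P ℤ.* (+ x ℤ.+ + y) ℤ.- + Q ℤ.* (+ j ℤ.+ + m ℤ.* + a))
    ℤ.- + a ℤ.* (+ P ℤ.* + y ℤ.- + Q ℤ.* + m) ℤ.+ + Q ℤ.* + j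
    ≡⟨ cong₂ ℤ._+_ (cong₂ (λ u v → + a ℤ.* u ℤ.- + a ℤ.* v)
                     (cong₂ ℤ._-_ (trans (cong (ℤ._*_ (+ P)) (sym (ℤ.pos-+ x y))) (sym (ℤ.pos-* P (x + y))))
                                  (trans (cong (ℤ._*_ (+ Q)) (sym +N)) (sym (ℤ.pos-* Q N))))
                     (cong₂ ℤ._-_ (sym (ℤ.pos-* P y)) (sym (ℤ.pos-* Q m))))
                   (sym (ℤ.pos-* Q j)) ⟩
  + a ℤ.* (+ (P * (x + y)) ℤ.- + (Q * N)) ℤ.- + a ℤ.* (+ (P * y) ℤ.- + (Q * m)) ℤ.+ + (Q * j) ∎
  where
  open ≡-Reasoning
  m = N / a
  j = N % a
  +N : + N ≡ + j ℤ.+ + m ℤ.* + a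
  +N = trans (cong +_ (m≡m%n+[m/n]*n N a)) (trans (ℤ.pos-+ j (m * a)) (cong (ℤ._+_ (+ j)) (ℤ.pos-* m a)))
  identity : ∀ B P Q X Y M J →
    (ℤ.1ℤ ℤ.+ B) ℤ.* P ℤ.* X ℤ.- B ℤ.* Q ℤ.* (J ℤ.+ M ℤ.* (ℤ.1ℤ ℤ.+ B)) ≡
    (ℤ.1ℤ ℤ.+ B) ℤ.* (P ℤ.* (X ℤ.+ Y) ℤ.- Q ℤ.* (J ℤ.+ M ℤ.* (ℤ.1ℤ ℤ.+ B)))
      ℤ.- (ℤ.1ℤ ℤ.+ B) ℤ.* (P ℤ.* Y ℤ.- Q ℤ.* M) ℤ.+ Q ℤ.* J
  identity = ℤ-Solver.solve-∀

recip≃ : ∀ n .{{_ : NonZero n}} → toℚᵘ (recip n) ℚᵘ.≃ + 1 ℚᵘ./ n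
recip≃ (suc n) = ℚ.toℚᵘ-fromℚᵘ (mkℚᵘ (+ 1) n)

/-+-recip : ∀ r p d .{{_ : NonZero p}} .{{_ : NonZero d}} .{{_ : NonZero (d * p)}} →
  (+ r ℚᵘ./ p) ℚᵘ.+ (+ 1 ℚᵘ./ d) ℚᵘ.≃ + (r * d + p) ℚᵘ./ (d * p)
/-+-recip r p@(suc _) d@(suc _) = *≡* (cong₂ ℤ._*_ numerator (cong +_ (*-comm d p)))
  where
  numerator : + r ℤ.* + d ℤ.+ + 1 ℤ.* + p ≡ + (r * d + p)
  numerator = trans (cong₂ ℤ._+_ (sym (ℤ.pos-* r d)) (ℤ.*-identityˡ (+ p))) (sym (ℤ.pos-+ (r * d) p))

/-≤⇒ : ∀ {m r} p .{{_ : NonZero p}} → mkℚᵘ (+ m) 0 ℚᵘ.≤ + r ℚᵘ./ p → m * p ≤ r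
/-≤⇒ {m} {r} (suc p) le = ≤-trans (mkℚᵘ-≤⇒ le) (≤-reflexive (*-identityʳ r))

module Sieve (a : ℕ → ℕ) {{a≢0 : ∀ {i} → NonZero (a i)}} where

  Unsieved : ℕ → Subset
  Unsieved zero    _ = true
  Unsieved (suc k)   = Unsieved k ∩ ∁ (divisibleBy (a k))

  -- P k = ∏_{i<k} aᵢ, Q k = ∏_{i<k} (aᵢ - 1) and R k / P k = ∑_{i<k} 1/aᵢ;
  -- E k bounds the error of the sieve estimate Q k / P k · N for count (Unsieved k) N.
  P Q R E : ℕ → ℕ
  P zero    = 1
  P (suc k) = a k * P k
  Q zero    = 1
  Q (suc k) = (a k ∸ 1) * Q k
  R zero    = 0
  R (suc k) = R k * a k + P k
  E zero    = 0
  E (suc k) = 2 * a k * E k + a k * Q k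

  P≢0 : ∀ k → NonZero (P k)
  P≢0 zero    = _
  P≢0 (suc k) = m*n≢0 (a k) (P k) {{a≢0}} {{P≢0 k}}

  Q≤P : ∀ k → Q k ≤ P k
  Q≤P zero    = ≤-refl
  Q≤P (suc k) = *-mono-≤ (m∸n≤m (a k) 1) (Q≤P k)

  -- ∏ (1 - 1/aᵢ) · (1 + ∑ 1/aᵢ) ≤ 1, cleared of denominators.
  Q[P+R]≤P² : ∀ k → Q k * (P k + R k) ≤ P k * P k
  Q[P+R]≤P² zero    = ≤-refl
  Q[P+R]≤P² (suc k) = begin
    (a k ∸ 1) * Q k * (a k * P k + (R k * a k + P k))       ≡⟨ expand (a k ∸ 1) (a k) (Q k) (P k) (R k) ⟩
    (a k ∸ 1) * a k * (Q k * (P k + R k)) + (a k ∸ 1) * (Q k * P k)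
      ≤⟨ +-mono-≤ (*-monoʳ-≤ ((a k ∸ 1) * a k) (Q[P+R]≤P² k)) (*-monoʳ-≤ (a k ∸ 1) (*-monoˡ-≤ (P k) (Q≤P k))) ⟩
    (a k ∸ 1) * a k * (P k * P k) + (a k ∸ 1) * (P k * P k) ≡⟨ collect (a k ∸ 1) (a k) (P k * P k) ⟩
    (a k ∸ 1) * suc (a k) * (P k * P k)                     ≤⟨ *-monoˡ-≤ (P k * P k) (pred[n]*[1+n]≤n*n (a k)) ⟩
    a k * a k * (P k * P k)                                 ≡⟨ interchange (a k) (P k) ⟩
    a k * P k * (a k * P k)                                 ∎
    where
    open ≤-Reasoning
    expand : ∀ c a Q P R → c * Q * (a * P + (R * a + P)) ≡ c * a * (Q * (P + R)) + c * (Q * P)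
    expand = solve-∀
    collect : ∀ c a S → c * a * S + c * S ≡ c * suc a * S
    collect = solve-∀
    interchange : ∀ a P → a * a * (P * P) ≡ a * P * (a * P)
    interchange = solve-∀
    square : ∀ n → suc (n * suc (suc n)) ≡ suc n * suc n
    square = solve-∀
    pred[n]*[1+n]≤n*n : ∀ n → (n ∸ 1) * suc n ≤ n * n
    pred[n]*[1+n]≤n*n zero    = z≤n
    pred[n]*[1+n]≤n*n (suc n) = ≤-trans (n≤1+n _) (≤-reflexive (square n))

  recipSum≃R/P : ∀ k → toℚᵘ (recipSum a k) ℚᵘ.≃ ℚᵘ._/_ (+ R k) (P k) {{P≢0 k}}
  recipSum≃R/P zero    = *≡* refl
  recipSum≃R/P (suc k) = begin
    toℚᵘ (recipSum a k ℚ.+ recip (a k))                 ≈⟨ ℚ.toℚᵘ-homo-+ (recipSum a k) (recip (a k)) ⟩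
    toℚᵘ (recipSum a k) ℚᵘ.+ toℚᵘ (recip (a k))         ≈⟨ ℚᵘ.+-cong (recipSum≃R/P k) (recip≃ (a k)) ⟩
    ℚᵘ._/_ (+ R k) (P k) {{P≢0 k}} ℚᵘ.+ (+ 1 ℚᵘ./ a k)
      ≈⟨ /-+-recip (R k) (P k) (a k) {{P≢0 k}} {{a≢0}} {{P≢0 (suc k)}} ⟩
    ℚᵘ._/_ (+ R (suc k)) (P (suc k)) {{P≢0 (suc k)}}    ∎
    where open ℚᵘ.≃-Reasoning

  M≤recipSum⇒M*Q≤P : ∀ M k → (+ M) ℚ./ 1 ℚ.≤ recipSum a k → M * Q k ≤ P k
  M≤recipSum⇒M*Q≤P M k M≤∑ = *-cancelʳ-≤ (M * Q k) (P k) (P k) {{P≢0 k}} (begin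
    M * Q k * P k          ≡⟨ rotate M (Q k) (P k) ⟩
    Q k * (M * P k)        ≤⟨ *-monoʳ-≤ (Q k) M*P≤R ⟩
    Q k * R k              ≤⟨ *-monoʳ-≤ (Q k) (m≤n+m (R k) (P k)) ⟩
    Q k * (P k + R k)      ≤⟨ Q[P+R]≤P² k ⟩
    P k * P k              ∎)
    where
    open ≤-Reasoning
    rotate : ∀ m q p → m * q * p ≡ q * (m * p)
    rotate = solve-∀
    M*P≤R : M * P k ≤ R k
    M*P≤R = /-≤⇒ (P k) {{P≢0 k}} (ℚᵘ.≤-respʳ-≃ (recipSum≃R/P k)
              (ℚᵘ.≤-respˡ-≃ (ℚ.toℚᵘ-fromℚᵘ (mkℚᵘ (+ M) 0)) (ℚ.toℚᵘ-mono-≤ M≤∑)))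

  module _ (coprime : ∀ i j → i ≢ j → Coprime (a i) (a j)) where

    unsieved-*-coprime : ∀ k {c} q → (∀ {i} → i < k → Coprime (a i) c) → Unsieved k (q * c) ≡ Unsieved k q
    unsieved-*-coprime zero        q _   = refl
    unsieved-*-coprime (suc k) {c} q cop =
      cong₂ (λ u v → u ∧ not v) (unsieved-*-coprime k q (λ i<k → cop (m<n⇒m<1+n i<k)))
        (does-⇔ (mk⇔ (λ ak∣qc → coprime-divisor (cop ≤-refl) (subst (a k ∣_) (*-comm q c) ak∣qc))
                     (λ ak∣q → ∣-trans ak∣q (m∣m*n c)))
                (a k ∣? q * c) (a k ∣? q))

    unsieved-∩-divisible : ∀ k n → (Unsieved k ∩ divisibleBy (a k)) n ≡ multiples (a k) (Unsieved k) n
    unsieved-∩-divisible k n with a k ∣? n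
    ... | no  _    = ∧-zeroʳ (Unsieved k n)
    ... | yes ak∣n = begin
      Unsieved k n ∧ true               ≡⟨ ∧-identityʳ (Unsieved k n) ⟩
      Unsieved k n                      ≡⟨ cong (Unsieved k) (m/n*n≡m ak∣n) ⟨
      Unsieved k (n / a k * a k)        ≡⟨ unsieved-*-coprime k (n / a k) (λ i<k → coprime _ k (<⇒≢ i<k)) ⟩
      Unsieved k (n / a k)              ∎
      where open ≡-Reasoning

    count-unsieved-suc : ∀ k N → count (Unsieved k) N ≡ count (Unsieved (suc k)) N + count (Unsieved k) (N / a k)
    count-unsieved-suc k N = begin
      count (Unsieved k) N
        ≡⟨ count-∩-∁ (Unsieved k) (divisibleBy (a k)) N ⟩
      count (Unsieved k ∩ divisibleBy (a k)) N + count (Unsieved (suc k)) N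
        ≡⟨ cong (_+ count (Unsieved (suc k)) N) (count-cong (unsieved-∩-divisible k) N) ⟩
      count (multiples (a k) (Unsieved k)) N + count (Unsieved (suc k)) N
        ≡⟨ cong (_+ count (Unsieved (suc k)) N) (count-multiples (a k) (Unsieved k) N) ⟩
      count (Unsieved k) (N / a k) + count (Unsieved (suc k)) N
        ≡⟨ +-comm (count (Unsieved k) (N / a k)) _ ⟩
      count (Unsieved (suc k)) N + count (Unsieved k) (N / a k) ∎
      where open ≡-Reasoning

    sieve-error : ∀ k N → ℤ.∣ + (P k * count (Unsieved k) N) ℤ.- + (Q k * N) ∣ ≤ E k
    sieve-error zero N = ≤-reflexive (cong ℤ.∣_∣ (trans (cong (λ c → + (1 * c) ℤ.- + (1 * N)) (count-all N))
                                                        (ℤ.+-inverseʳ (+ (1 * N)))))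
      where
      count-all : ∀ N → count (Unsieved zero) N ≡ N
      count-all zero    = refl
      count-all (suc N) = cong suc (count-all N)
    sieve-error (suc k) N = begin
      ℤ.∣ + (a k * P k * x) ℤ.- + ((a k ∸ 1) * Q k * N) ∣
        ≡⟨ cong ℤ.∣_∣ (sieve-error-step (a k) (P k) (Q k) x y N) ⟩
      ℤ.∣ + a k ℤ.* e₁ ℤ.- + a k ℤ.* e₂ ℤ.+ + (Q k * (N % a k)) ∣
        ≤⟨ ∣ai-aj+k∣≤ (a k) e₁ e₂ (Q k * (N % a k)) ⟩
      a k * ℤ.∣ e₁ ∣ + a k * ℤ.∣ e₂ ∣ + Q k * (N % a k)
        ≤⟨ +-mono-≤ (+-mono-≤ (*-monoʳ-≤ (a k) e₁≤E) (*-monoʳ-≤ (a k) (sieve-error k (N / a k))))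
                    (*-monoʳ-≤ (Q k) (<⇒≤ (m%n<n N (a k)))) ⟩
      a k * E k + a k * E k + Q k * a k
        ≡⟨ regroup (a k) (E k) (Q k) ⟩
      2 * a k * E k + a k * Q k ∎
      where
      open ≤-Reasoning
      x = count (Unsieved (suc k)) N
      y = count (Unsieved k) (N / a k)
      e₁ e₂ : ℤ
      e₁ = + (P k * (x + y)) ℤ.- + (Q k * N)
      e₂ = + (P k * y) ℤ.- + (Q k * (N / a k))
      e₁≤E : ℤ.∣ e₁ ∣ ≤ E k
      e₁≤E = subst (λ c → ℤ.∣ + (P k * c) ℤ.- + (Q k * N) ∣ ≤ E k) (count-unsieved-suc k N) (sieve-error k N)
      regroup : ∀ a e q → a * e + a * e + q * a ≡ 2 * a * e + a * q
      regroup = solve-∀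

    unsieved-count-≤ : ∀ k N → P k * count (Unsieved k) N ≤ Q k * N + E k
    unsieved-count-≤ k N = ≤-trans (m≤n+∣[+m]-[+n]∣ _ (Q k * N)) (+-monoʳ-≤ (Q k * N) (sieve-error k N))

    unsieved-sparse : (∀ M → ∃ λ k → (+ M) ℚ./ 1 ℚ.≤ recipSum a k) → ∀ r → ∃ λ k → Sparse r (Unsieved k)
    unsieved-sparse divergent r with divergent (2 * r)
    ... | k , 2r≤∑ = k , count-bound⇒sparse (P k) (Q k) (E k) r {{P≢0 k}} (unsieved-count-≤ k)
                           (M≤recipSum⇒M*Q≤P (2 * r) k 2r≤∑)

ProdSet-∋ : ∀ S {x y m} → x ≤ m → y ≤ m → S x ≡ true → S y ≡ true → x * y ≡ m → ProdSet S m ≡ true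
ProdSet-∋ S {x} {y} {m} x≤m y≤m Sx Sy xy≡m =
  Equivalence.to T-≡ (any⁺ _ (Any.map (λ { refl → some-y }) (∈-upTo⁺ (s≤s x≤m))))
  where
  pair : T (S x ∧ (S y ∧ ⌊ x * y ≟ m ⌋))
  pair rewrite Sx | Sy = fromWitness xy≡m
  some-y : T (any (λ b → S x ∧ (S b ∧ ⌊ x * b ≟ m ⌋)) (upTo (suc m)))
  some-y = any⁺ _ (Any.map (λ { refl → pair }) (∈-upTo⁺ (s≤s y≤m)))

∈-ProdSet : ∀ S {x y} → S x ≡ true → S y ≡ true → ProdSet S (x * y) ≡ true
∈-ProdSet S {zero}  {y}     S0 _  = ProdSet-∋ S z≤n z≤n S0 S0 refl
∈-ProdSet S {suc x} {zero}  _  S0 = ProdSet-∋ S z≤n z≤n S0 S0 (sym (*-zeroʳ x))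
∈-ProdSet S {suc x} {suc y} Sx Sy = ProdSet-∋ S (m≤m*n (suc x) (suc y)) (m≤n*m (suc y) (suc x)) Sx Sy refl

module _ (A : Subset) (a : ℕ → ℕ) {{a≢0 : ∀ {i} → NonZero (a i)}} where
  open Sieve a using (Unsieved)

  multiplesOfNonMembers : ℕ → Subset
  multiplesOfNonMembers zero    = ∅
  multiplesOfNonMembers (suc k) = multiplesOfNonMembers k ∪ multiples (a k) (∁ A)

  multiplesOfNonMembers-densityZero : DensityZero (∁ A) → ∀ k → DensityZero (multiplesOfNonMembers k)
  multiplesOfNonMembers-densityZero dz zero    = densityZero-∅
  multiplesOfNonMembers-densityZero dz (suc k) =
    densityZero-∪ (multiplesOfNonMembers-densityZero dz k) (densityZero-multiples (a k) dz)

  ∁ProdSet⊆ : (∀ i → A (a i) ≡ true) → ∀ k → ∁ (ProdSet A) ⊆ (Unsieved k ∪ multiplesOfNonMembers k)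
  ∁ProdSet⊆ A∋a zero    n _     = refl
  ∁ProdSet⊆ A∋a (suc k) n n∉A² with a k ∣? n
  ... | no _ = trans (cong₂ _∨_ (∧-identityʳ (Unsieved k n)) (∨-identityʳ (multiplesOfNonMembers k n)))
                     (∁ProdSet⊆ A∋a k n n∉A²)
  ... | yes ak∣n with A (n / a k) in A∋n/ak
  ...   | false = trans (cong (Unsieved k n ∧ false ∨_) (∨-zeroʳ (multiplesOfNonMembers k n)))
                          (∨-zeroʳ (Unsieved k n ∧ false))
  ...   | true  with () ← trans (sym n∉A²)
                       (cong not (subst (λ m → ProdSet A m ≡ true) (m*[n/m]≡n ak∣n) (∈-ProdSet A (A∋a k) A∋n/ak)))

proposition4 : (A : Subset) → A 0 ≡ false → A 1 ≡ false → HasDensity A 1ℚ →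
    (a : ℕ → ℕ) → (∀ i → A (a i) ≡ true) → (∀ i j → i < j → a i < a j) →
    (∀ i j → i ≢ j → Coprime (a i) (a j)) →
    (∀ (M : ℕ) → ∃ λ k → ((+ M) ℚ./ 1) ℚ.≤ recipSum a k) →
    HasDensity (ProdSet A) 1ℚ
proposition4 A A0≡false _ A-dense a A∋a _ coprime divergent =
  ∁-densityZero⇒density-1 (ProdSet A) ∁A²-densityZero
  where
  instance
    a≢0 : ∀ {i} → NonZero (a i)
    a≢0 {i} = ≢-nonZero a[i]≢0
      where
      a[i]≢0 : a i ≢ 0
      a[i]≢0 ai≡0 with () ← trans (sym (subst (λ n → A n ≡ true) ai≡0 (A∋a i))) A0≡false
  ∁A²-densityZero : DensityZero (∁ (ProdSet A))
  ∁A²-densityZero r with Sieve.unsieved-sparse a coprime divergent (2 * r)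
  ... | k , unsieved-sparse =
    sparse-≤ {r} (count-mono-⊆ (∁ProdSet⊆ A a A∋a k))
      (sparse-∪ {r} unsieved-sparse
        (multiplesOfNonMembers-densityZero A a (density-1⇒∁-densityZero A A-dense) k (2 * r)))
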